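{- Let $n\ge1$ and let $\mathbf{L}$ be a De~Morgan lattice. The $n$-prime filters on $\mathbf{L}$ are precisely the sets $h^{ -1}[G]$ for De~Morgan lattice homomorphisms $h\colon\mathbf{L}\to(\mathbf{DM}_1)^n$, where $G$ is the designated set of the direct power $(\boldsymbol{\mathcal{DM}}_1)^n$. Likewise the complete (respectively consistent, classical) $n$-prime filters on $\mathbf{L}$ are precisely the homomorphic preimages of the designated set of $(\boldsymbol{\mathcal{P}}_1)^n$ (respectively $(\boldsymbol{\mathcal{K}}_1)^n$, $(\boldsymbol{\mathcal{B}}_1)^n$).
   Context: A De~Morgan lattice is a distributive lattice with unary $\neg$ satisfying $\neg\neg x=x$ and the De~Morgan laws. $\mathbf{DM}_1$ is the four-element De~Morgan lattice on $\{\mathsf f,\mathsf n,\mathsf b,\mathsf t\}$ with $\mathsf f<\mathsf n,\mathsf b<\mathsf t$, $\mathsf n,\mathsf b$ incomparable, $\neg\mathsf t=\mathsf f$, $\neg\mathsf n=\mathsf n$, $\neg\mathsf b=\mathsf b$. $\boldsymbol{\mathcal{DM}}_1=\langle\mathbf{DM}_1,\{\mathsf t,\mathsf b\}\rangle$; $\boldsymbol{\mathcal{P}}_1$, $\boldsymbol{\mathcal{K}}_1$, $\boldsymbol{\mathcal{B}}_1$ are its substructures with universes $\{\mathsf t,\mathsf b,\mathsf f\}$, $\{\mathsf t,\mathsf n,\mathsf f\}$, $\{\mathsf t,\mathsf f\}$ and designated sets $\{\mathsf t,\mathsf b\}$, $\{\mathsf t\}$, $\{\mathsf t\}$. The direct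 power of a structure $\langle\mathbf{A},F\rangle$ is $\langle\mathbf{A}^n,\bigcap_k\pi_k^{ -1}[F]\rangle$ (tuples all of whose coordinates are designated). An $n$-ideal is an $n$-filter of the order dual lattice, where an $n$-filter is an upset $F$ such that for every non-empty finite $Y$: if $\bigwedge X\in F$ for all non-empty $X\subseteq Y$ with $|X|\le n$, then $\bigwedge Y\in F$. A filter $F$ is $n$-prime if its complement is an $n$-ideal. A filter is complete if it is non-empty and $x\in F$ implies $x\wedge(y\vee\neg y)\in F$; consistent if $F\ne L$ and $(x\wedge\neg x)\vee y\in F$ implies $y\in F$; classical if both complete and consistent. -}

module Defs where

open import Level using (Level; _⊔_) renaming (suc to lsuc)
open import Data.Nat using (ℕ; zero; suc; _≤_)
open import Data.Fin using (Fin; zero; suc)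
open import Data.Product using (Σ; ∃; _×_; _,_)
open import Data.Unit using (⊤)
open import Data.Empty using (⊥)
open import Function using (_∘_)
open import Function.Bundles using (_⇔_)
open import Relation.Unary using (Pred; _∈_; ∁)
open import Relation.Binary.PropositionalEquality using (_≡_; _≢_)
open import Algebra.Lattice.Bundles using (DistributiveLattice)

record DeMorganLattice c ℓ : Set (lsuc (c ⊔ ℓ)) where
  infix 8 ~_
  field
    distributiveLattice : DistributiveLattice c ℓ
  open DistributiveLattice distributiveLattice public
  field
    ~_           : Carrier → Carrier
    ~-cong       : ∀ {x y} → x ≈ y → ~ x ≈ ~ y
    ~-involutive : ∀ x → ~ (~ x) ≈ x
    deMorgan-∧   : ∀ x y → ~ (x ∧ y) ≈ (~ x ∨ ~ y)
    deMorgan-∨   : ∀ x y → ~ (x ∨ y) ≈ (~ x ∧ ~ y)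

-- The four-element De Morgan lattice DM₁ (f < n, b < t; ~n = n, ~b = b)

data DM4 : Set where
  𝖿 𝗇 𝖻 𝗍 : DM4

_⊓_ : DM4 → DM4 → DM4
𝖿 ⊓ y = 𝖿
𝗍 ⊓ y = y
𝗇 ⊓ 𝖿 = 𝖿
𝗇 ⊓ 𝗇 = 𝗇
𝗇 ⊓ 𝖻 = 𝖿
𝗇 ⊓ 𝗍 = 𝗇
𝖻 ⊓ 𝖿 = 𝖿
𝖻 ⊓ 𝗇 = 𝖿
𝖻 ⊓ 𝖻 = 𝖻
𝖻 ⊓ 𝗍 = 𝖻

_⊔₄_ : DM4 → DM4 → DM4
𝗍 ⊔₄ y = 𝗍
𝖿 ⊔₄ y = y
𝗇 ⊔₄ 𝗍 = 𝗍
𝗇 ⊔₄ 𝗇 = 𝗇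
𝗇 ⊔₄ 𝖻 = 𝗍
𝗇 ⊔₄ 𝖿 = 𝗇
𝖻 ⊔₄ 𝗍 = 𝗍
𝖻 ⊔₄ 𝗇 = 𝗍
𝖻 ⊔₄ 𝖻 = 𝖻
𝖻 ⊔₄ 𝖿 = 𝖻

neg₄ : DM4 → DM4
neg₄ 𝖿 = 𝗍
neg₄ 𝗇 = 𝗇
neg₄ 𝖻 = 𝖻
neg₄ 𝗍 = 𝖿

UnivDM₁ UnivP₁ UnivK₁ UnivB₁ : DM4 → Set
UnivDM₁ _ = ⊤
UnivP₁ v = v ≢ 𝗇
UnivK₁ v = v ≢ 𝖻
UnivB₁ v = (v ≢ 𝗇) × (v ≢ 𝖻)

data Des-tb : DM4 → Set where
  des-t : Des-tb 𝗍
  des-b : Des-tb 𝖻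

DesDM₁ DesP₁ DesK₁ DesB₁ : DM4 → Set
DesDM₁ = Des-tb
DesP₁  = Des-tb
DesK₁  v = v ≡ 𝗍
DesB₁  v = v ≡ 𝗍

module _ {c ℓ : Level} (L : DeMorganLattice c ℓ) where
  open DeMorganLattice L

  _≤L_ : Carrier → Carrier → Set ℓ
  x ≤L y = (x ∧ y) ≈ x

  ⋀ : ∀ {k} → (Fin (suc k) → Carrier) → Carrier
  ⋀ {zero}  g = g zero
  ⋀ {suc k} g = g zero ∧ ⋀ (λ i → g (suc i))

  ⋁ : ∀ {k} → (Fin (suc k) → Carrier) → Carrier
  ⋁ {zero}  g = g zero
  ⋁ {suc k} g = g zero ∨ ⋁ (λ i → g (suc i))

  module _ {p : Level} where

    IsUpset : Pred Carrier p → Set (c ⊔ ℓ ⊔ p)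
    IsUpset F = ∀ {x y} → x ≤L y → x ∈ F → y ∈ F

    IsDownset : Pred Carrier p → Set (c ⊔ ℓ ⊔ p)
    IsDownset I = ∀ {x y} → x ≤L y → y ∈ I → x ∈ I

    -- filter: upset closed under binary meets (possibly empty)
    IsFilter : Pred Carrier p → Set (c ⊔ ℓ ⊔ p)
    IsFilter F = IsUpset F × (∀ {x y} → x ∈ F → y ∈ F → (x ∧ y) ∈ F)

    -- A non-empty finite set Y is given as a family
    -- Y : Fin (suc k) → Carrier; a non-empty subset X ⊆ Y with |X| ≤ n is
    -- given as a family of indices X : Fin (suc m) → Fin (suc k), suc m ≤ n.
    IsNFilter : ℕ → Pred Carrier p → Set (c ⊔ ℓ ⊔ p)
    IsNFilter n F = IsUpset F ×
      (∀ k (Y : Fin (suc k) → Carrier) →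
        (∀ m (X : Fin (suc m) → Fin (suc k)) → suc m ≤ n → ⋀ (Y ∘ X) ∈ F) →
        ⋀ Y ∈ F)

    IsNIdeal : ℕ → Pred Carrier p → Set (c ⊔ ℓ ⊔ p)
    IsNIdeal n I = IsDownset I ×
      (∀ k (Y : Fin (suc k) → Carrier) →
        (∀ m (X : Fin (suc m) → Fin (suc k)) → suc m ≤ n → ⋁ (Y ∘ X) ∈ I) →
        ⋁ Y ∈ I)

    IsNPrimeFilter : ℕ → Pred Carrier p → Set (c ⊔ ℓ ⊔ p)
    IsNPrimeFilter n F = IsFilter F × IsNIdeal n (∁ F)

    IsComplete : Pred Carrier p → Set (c ⊔ p)
    IsComplete F = (∃ λ x → x ∈ F) × (∀ x y → x ∈ F → (x ∧ (y ∨ ~ y)) ∈ F)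

    IsConsistent : Pred Carrier p → Set (c ⊔ p)
    IsConsistent F = ((∀ x → x ∈ F) → ⊥) × (∀ x y → ((x ∧ ~ x) ∨ y) ∈ F → y ∈ F)

    IsClassical : Pred Carrier p → Set (c ⊔ p)
    IsClassical F = IsComplete F × IsConsistent F

  -- De Morgan lattice homomorphisms L → (DM₁)ⁿ (elements of the power are
  -- functions Fin n → DM4; equality in the power is pointwise)
  record IsDMHom (n : ℕ) (h : Carrier → Fin n → DM4) : Set (c ⊔ ℓ) where
    field
      cong   : ∀ {x y} → x ≈ y → ∀ i → h x i ≡ h y i
      hom-∧  : ∀ x y i → h (x ∧ y) i ≡ (h x i ⊓ h y i)
      hom-∨  : ∀ x y i → h (x ∨ y) i ≡ (h x i ⊔₄ h y i)
      hom-~  : ∀ x i → h (~ x) i ≡ neg₄ (h x i)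

  -- F is the preimage h⁻¹[G] of the designated set G of the direct power
  -- ⟨A, D⟩ⁿ (A ⊆ DM₁ a subuniverse with universe predicate U) under some
  -- De Morgan lattice homomorphism h : L → Aⁿ.
  IsHomPreimage : ∀ {p} → ℕ → (U D : DM4 → Set) → Pred Carrier p → Set (c ⊔ ℓ ⊔ p)
  IsHomPreimage n U D F =
    Σ (Carrier → Fin n → DM4) λ h →
      IsDMHom n h × (∀ x i → U (h x i)) ×
      (∀ x → (x ∈ F) ⇔ (∀ i → D (h x i)))

{-# OPTIONS --safe #-}
-- A homomorphism L → DM₁ⁿ is an n-tuple of homomorphisms L → DM₁. The preimage of {t, b}
-- under one of them is a prime filter, and conversely a prime filter Q yields the
-- homomorphism sending x to the Belnap value told true iff x ∈ Q and told false iff ~ x ∈ Q.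
-- So it remains to see that the n-prime filters are the intersections of n prime filters.
--
-- If F = Q₁ ∩ … ∩ Qₙ and ⋁ Y ∈ F, each Qᵢ contains some joinand of Y, and the join of these
-- n joinands lies in F. Conversely, call a₀, …, a_{k-1} a spread family of F when no aᵢ lies
-- in F but aᵢ ∨ aⱼ ∈ F for i ≠ j. For a spread family of size n + 1 the n + 1 meets
-- ⋀_{j≠i} aⱼ have their join in F, yet any n of them lie below a common aᵢ ∉ F; so spread
-- families have size at most n. For one of largest size, maximality makes the residuals
-- {x ∣ x ∨ aᵢ ∈ F} prime filters (using excluded middle), and their intersection is F.
--
-- Completeness of F forces every prime filter above F to contain x or ~ x, so no value is n;
-- consistency keeps a residual by aᵢ ∉ F from containing both, so no value is b.
module Submission where

open import Defs
open import Level using (_⊔_; Lift; lift; lower)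
open import Data.Bool using (Bool; true; false) renaming (_∧_ to _∧ᵇ_; _∨_ to _∨ᵇ_)
open import Data.Empty using (⊥; ⊥-elim)
open import Data.Fin using (Fin; zero; suc; punchIn; punchOut; inject≤)
open import Data.Fin.Properties
  using (suc-injective; punchIn-injective; punchInᵢ≢i; punchIn-punchOut; pigeonhole; any?; ¬∀⟶∃¬; _≟_; <-irrefl)
open import Data.Nat using (ℕ; zero; suc; _≤_; _<_; z≤n; s≤s)
open import Data.Nat.Properties using (m≤n⇒m≤1+n) renaming (≤-refl to ℕ-≤-refl)
open import Data.Product using (∃; _×_; _,_; proj₁; proj₂; map₁; map₂)
open import Data.Sum as Sum using (_⊎_; inj₁; inj₂; [_,_])
open import Data.Unit using (tt)
open import Data.Vec.Functional using (_∷_)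
open import Function using (_∘_; id)
open import Function.Bundles using (_⇔_; mk⇔; Equivalence)
open import Function.Definitions using (Injective)
open import Function.Properties.Equivalence using () renaming (trans to ⇔-trans)
open import Relation.Nullary using (¬_; Dec; yes; no; does)
open import Relation.Nullary.Decidable using (map′; dec-true; dec-false; does-⇔; _×-dec_; _⊎-dec_; decidable-stable)
open import Relation.Unary using (Pred; _∈_; _∉_; ∁)
open import Relation.Binary.PropositionalEquality as ≡ using (_≡_; _≢_; refl)
open import Axiom.ExcludedMiddle using (ExcludedMiddle)
import Algebra.Lattice.Properties.Lattice as LatticeProperties
import Relation.Binary.Lattice as OrderLattice
import Relation.Binary.Lattice.Properties.JoinSemilattice as JoinSemilatticeProperties

lowerEM : ∀ {a} b → ExcludedMiddle (a ⊔ b) → ExcludedMiddle a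
lowerEM b em = map′ lower lift (em {Lift b _})

does≡true⇔ : ∀ {a} {A : Set a} (a? : Dec A) → does a? ≡ true ⇔ A
does≡true⇔ {A = A} a? = mk⇔ (to a?) (dec-true a?)
  where
  to : (a? : Dec A) → does a? ≡ true → A
  to (yes a) _ = a
  to (no _)  ()

threshold : ∀ {e} {E : ℕ → Set e} → (∀ k → Dec (E k)) → E 0 →
            ∀ n → ¬ E (suc n) → ∃ λ k → k ≤ n × E k × ¬ E (suc k)
threshold E? E₀ zero    ¬E₁ = zero , z≤n , E₀ , ¬E₁
threshold E? E₀ (suc n) ¬E  with E? (suc n)
... | yes Eₙ = suc n , ℕ-≤-refl , Eₙ , ¬E
... | no ¬Eₙ = map₂ (map₁ m≤n⇒m≤1+n) (threshold E? E₀ n ¬Eₙ)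

∃-∉-image : ∀ {m n} → m < n → (f : Fin m → Fin n) → ∃ λ y → ∀ x → f x ≢ y
∃-∉-image {n = n} m<n f =
  map₂ (λ ¬∃x x fx≡y → ¬∃x (x , fx≡y)) (¬∀⟶∃¬ n _ (λ y → any? (λ x → f x ≟ y)) ¬surjective)
  where
  ¬surjective : ¬ (∀ y → ∃ λ x → f x ≡ y)
  ¬surjective surj with pigeonhole m<n (proj₁ ∘ surj)
  ... | i , j , i<j , xᵢ≡xⱼ =
    <-irrefl (≡.trans (≡.sym (proj₂ (surj i))) (≡.trans (≡.cong f xᵢ≡xⱼ) (proj₂ (surj j)))) i<j

clamp : ∀ {k m} → k ≤ m → Fin (suc m) → Fin (suc k)
clamp z≤n       _       = zero
clamp (s≤s k≤m) zero    = zero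
clamp (s≤s k≤m) (suc i) = suc (clamp k≤m i)

clamp-inject≤ : ∀ {k m} (k≤m : k ≤ m) (j : Fin (suc k)) → clamp k≤m (inject≤ j (s≤s k≤m)) ≡ j
clamp-inject≤ z≤n       zero    = refl
clamp-inject≤ (s≤s k≤m) zero    = refl
clamp-inject≤ (s≤s k≤m) (suc j) = ≡.cong suc (clamp-inject≤ k≤m j)

-- Belnap's reading: code a b is the value that is told true iff a and told false iff b.
code : Bool → Bool → DM4
code true  false = 𝗍
code true  true  = 𝖻
code false false = 𝗇
code false true  = 𝖿

code-⊓ : ∀ a b c d → code a b ⊓ code c d ≡ code (a ∧ᵇ c) (b ∨ᵇ d)
code-⊓ true  false c     d     = refl
code-⊓ false true  c     d     = refl
code-⊓ true  true  true  true  = refl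
code-⊓ true  true  true  false = refl
code-⊓ true  true  false true  = refl
code-⊓ true  true  false false = refl
code-⊓ false false true  true  = refl
code-⊓ false false true  false = refl
code-⊓ false false false true  = refl
code-⊓ false false false false = refl

code-⊔ : ∀ a b c d → code a b ⊔₄ code c d ≡ code (a ∨ᵇ c) (b ∧ᵇ d)
code-⊔ true  false c     d     = refl
code-⊔ false true  c     d     = refl
code-⊔ true  true  true  true  = refl
code-⊔ true  true  true  false = refl
code-⊔ true  true  false true  = refl
code-⊔ true  true  false false = refl
code-⊔ false false true  true  = refl
code-⊔ false false true  false = refl
code-⊔ false false false true  = refl
code-⊔ false false false false = refl

code-neg : ∀ a b → neg₄ (code a b) ≡ code b a
code-neg true  true  = refl
code-neg true  false = refl
code-neg false true  = refl
code-neg false false = refl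

Des-tb-code : ∀ a b → Des-tb (code a b) ⇔ a ≡ true
Des-tb-code a b = mk⇔ (to a b) (from b)
  where
  to : ∀ a b → Des-tb (code a b) → a ≡ true
  to true  _     _  = refl
  to false true  ()
  to false false ()
  from : ∀ b {a} → a ≡ true → Des-tb (code a b)
  from true  refl = des-b
  from false refl = des-t

code≡𝗍 : ∀ a b → code a b ≡ 𝗍 ⇔ (a ≡ true × b ≡ false)
code≡𝗍 a b = mk⇔ (to a b) λ { (refl , refl) → refl }
  where
  to : ∀ a b → code a b ≡ 𝗍 → a ≡ true × b ≡ false
  to true  false _  = refl , refl
  to true  true  ()
  to false true  ()
  to false false ()

code≢𝗇 : ∀ {a b} → a ≡ true ⊎ b ≡ true → code a b ≢ 𝗇
code≢𝗇 {true}  {true}  _ ()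
code≢𝗇 {false} {true}  _ ()
code≢𝗇 {false} {false} (inj₁ ()) _
code≢𝗇 {false} {false} (inj₂ ()) _

code≢𝖻 : ∀ {a b} → ¬ (a ≡ true × b ≡ true) → code a b ≢ 𝖻
code≢𝖻 {true}  {true}  ¬both _ = ¬both (refl , refl)
code≢𝖻 {true}  {false} _ ()
code≢𝖻 {false} {true}  _ ()
code≢𝖻 {false} {false} _ ()

record IsPrimeFilterWithin (U D : DM4 → Set) : Set where
  field
    upward : ∀ {a b} → a ⊓ b ≡ a → D a → D b
    meet   : ∀ {a b} → D a → D b → D (a ⊓ b)
    prime  : ∀ {a b} → U a → U b → D (a ⊔₄ b) → D a ⊎ D b

Des-tb-isPrimeFilterWithin : ∀ {U} → IsPrimeFilterWithin U Des-tb
Des-tb-isPrimeFilterWithin = record { upward = upward ; meet = meet ; prime = λ _ _ → prime _ _ }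
  where
  upward : ∀ {a b} → a ⊓ b ≡ a → Des-tb a → Des-tb b
  upward {b = 𝗍} _  _ = des-t
  upward {b = 𝖻} _  des-b = des-b
  upward {b = 𝖻} () des-t
  upward {b = 𝖿} () des-t
  upward {b = 𝖿} () des-b
  upward {b = 𝗇} () des-t
  upward {b = 𝗇} () des-b
  meet : ∀ {a b} → Des-tb a → Des-tb b → Des-tb (a ⊓ b)
  meet des-t d     = d
  meet des-b des-t = des-b
  meet des-b des-b = des-b
  prime : ∀ a b → Des-tb (a ⊔₄ b) → Des-tb a ⊎ Des-tb b
  prime 𝗍 _ _ = inj₁ des-t
  prime 𝖻 _ _ = inj₁ des-b
  prime 𝖿 𝗍 _ = inj₂ des-t
  prime 𝖿 𝖻 _ = inj₂ des-b
  prime 𝗇 𝗍 _ = inj₂ des-t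
  prime 𝗇 𝖻 _ = inj₂ des-b

≡𝗍-isPrimeFilterWithin : ∀ {U} → (∀ {v} → U v → v ≢ 𝖻) → IsPrimeFilterWithin U (_≡ 𝗍)
≡𝗍-isPrimeFilterWithin U⇒≢𝖻 = record
  { upward = upward ; meet = meet ; prime = λ Ua Ub → prime _ _ (U⇒≢𝖻 Ua) (U⇒≢𝖻 Ub) }
  where
  upward : ∀ {a b} → a ⊓ b ≡ a → a ≡ 𝗍 → b ≡ 𝗍
  upward a⊓b≡a refl = a⊓b≡a
  meet : ∀ {a b} → a ≡ 𝗍 → b ≡ 𝗍 → a ⊓ b ≡ 𝗍
  meet refl refl = refl
  prime : ∀ a b → a ≢ 𝖻 → b ≢ 𝖻 → a ⊔₄ b ≡ 𝗍 → a ≡ 𝗍 ⊎ b ≡ 𝗍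
  prime 𝗍 _ _ _ _ = inj₁ refl
  prime 𝖻 _ a≢𝖻 _ _ = ⊥-elim (a≢𝖻 refl)
  prime _ 𝗍 _ _ _ = inj₂ refl
  prime _ 𝖻 _ b≢𝖻 _ = ⊥-elim (b≢𝖻 refl)
  prime 𝖿 𝖿 _ _ ()
  prime 𝖿 𝗇 _ _ ()
  prime 𝗇 𝖿 _ _ ()
  prime 𝗇 𝗇 _ _ ()

DesDM₁-isPrimeFilterWithin : IsPrimeFilterWithin UnivDM₁ DesDM₁
DesDM₁-isPrimeFilterWithin = Des-tb-isPrimeFilterWithin

DesP₁-isPrimeFilterWithin : IsPrimeFilterWithin UnivP₁ DesP₁
DesP₁-isPrimeFilterWithin = Des-tb-isPrimeFilterWithin

DesK₁-isPrimeFilterWithin : IsPrimeFilterWithin UnivK₁ DesK₁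
DesK₁-isPrimeFilterWithin = ≡𝗍-isPrimeFilterWithin id

DesB₁-isPrimeFilterWithin : IsPrimeFilterWithin UnivB₁ DesB₁
DesB₁-isPrimeFilterWithin = ≡𝗍-isPrimeFilterWithin proj₂

Des-tb-⊔neg : ∀ v → v ≢ 𝗇 → Des-tb (v ⊔₄ neg₄ v)
Des-tb-⊔neg 𝖿 _   = des-t
Des-tb-⊔neg 𝗇 v≢𝗇 = ⊥-elim (v≢𝗇 refl)
Des-tb-⊔neg 𝖻 _   = des-b
Des-tb-⊔neg 𝗍 _   = des-t

⊔neg≡𝗍 : ∀ v → UnivB₁ v → v ⊔₄ neg₄ v ≡ 𝗍
⊔neg≡𝗍 𝖿 _           = refl
⊔neg≡𝗍 𝗇 (v≢𝗇 , _)   = ⊥-elim (v≢𝗇 refl)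
⊔neg≡𝗍 𝖻 (_ , v≢𝖻)   = ⊥-elim (v≢𝖻 refl)
⊔neg≡𝗍 𝗍 _           = refl

⊓neg≢𝗍 : ∀ v → v ⊓ neg₄ v ≢ 𝗍
⊓neg≢𝗍 𝖿 ()
⊓neg≢𝗍 𝗇 ()
⊓neg≢𝗍 𝖻 ()
⊓neg≢𝗍 𝗍 ()

⊓neg-⊔-≡𝗍 : ∀ {v w} → v ≢ 𝖻 → w ≢ 𝖻 → (v ⊓ neg₄ v) ⊔₄ w ≡ 𝗍 → w ≡ 𝗍
⊓neg-⊔-≡𝗍 {w = 𝗍} _   _   _ = refl
⊓neg-⊔-≡𝗍 {w = 𝖻} _   w≢𝖻 _ = ⊥-elim (w≢𝖻 refl)
⊓neg-⊔-≡𝗍 {𝖻}     v≢𝖻 _   _ = ⊥-elim (v≢𝖻 refl)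
⊓neg-⊔-≡𝗍 {𝖿} {𝖿} _ _ ()
⊓neg-⊔-≡𝗍 {𝖿} {𝗇} _ _ ()
⊓neg-⊔-≡𝗍 {𝗇} {𝖿} _ _ ()
⊓neg-⊔-≡𝗍 {𝗇} {𝗇} _ _ ()
⊓neg-⊔-≡𝗍 {𝗍} {𝖿} _ _ ()
⊓neg-⊔-≡𝗍 {𝗍} {𝗇} _ _ ()

module _ {c ℓ} (L : DeMorganLattice c ℓ) where
  open DeMorganLattice L renaming (refl to ≈-refl; sym to ≈-sym; trans to ≈-trans)
  open OrderLattice.Lattice (LatticeProperties.∨-∧-orderTheoreticLattice lattice)
    using (x≤x∨y; y≤x∨y; ∨-least; x∧y≤x; x∧y≤y; joinSemilattice)
    renaming (_≤_ to _≼_; refl to ≼-refl; trans to ≼-trans; reflexive to ≼-reflexive)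
  open JoinSemilatticeProperties joinSemilattice using (∨-monotonic)

  ⋀-lower : ∀ {k} (g : Fin (suc k) → Carrier) j → ⋀ L g ≼ g j
  ⋀-lower {zero}  g zero    = ≼-refl
  ⋀-lower {suc k} g zero    = x∧y≤x _ _
  ⋀-lower {suc k} g (suc j) = ≼-trans (x∧y≤y _ _) (⋀-lower (g ∘ suc) j)

  ⋁-upper : ∀ {k} (g : Fin (suc k) → Carrier) j → g j ≼ ⋁ L g
  ⋁-upper {zero}  g zero    = ≼-refl
  ⋁-upper {suc k} g zero    = x≤x∨y _ _
  ⋁-upper {suc k} g (suc j) = ≼-trans (⋁-upper (g ∘ suc) j) (y≤x∨y _ _)

  ⋁-least : ∀ {k} (g : Fin (suc k) → Carrier) {z} → (∀ j → g j ≼ z) → ⋁ L g ≼ z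
  ⋁-least {zero}  g g≼z = g≼z zero
  ⋁-least {suc k} g g≼z = ∨-least (g≼z zero) (⋁-least (g ∘ suc) (g≼z ∘ suc))

  ∧-distribˡ-⋁ : ∀ {k} x (g : Fin (suc k) → Carrier) → x ∧ ⋁ L g ≈ ⋁ L (λ i → x ∧ g i)
  ∧-distribˡ-⋁ {zero}  x g = ≈-refl
  ∧-distribˡ-⋁ {suc k} x g = ≈-trans (∧-distribˡ-∨ x _ _) (∨-congˡ (∧-distribˡ-⋁ x (g ∘ suc)))

  module FilterProperties {q} {F : Pred Carrier q} (isFilter : IsFilter L F) where

    ∈-mono : ∀ {x y} → x ≼ y → x ∈ F → y ∈ F
    ∈-mono x≼y = proj₁ isFilter (≈-sym x≼y)

    ∈-resp-≈ : ∀ {x y} → x ≈ y → x ∈ F → y ∈ F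
    ∈-resp-≈ = ∈-mono ∘ ≼-reflexive

    ∧-∈ : ∀ {x y} → x ∈ F → y ∈ F → x ∧ y ∈ F
    ∧-∈ = proj₂ isFilter

    ∧-∈⇔ : ∀ {x y} → x ∧ y ∈ F ⇔ (x ∈ F × y ∈ F)
    ∧-∈⇔ = mk⇔ (λ x∧y∈F → ∈-mono (x∧y≤x _ _) x∧y∈F , ∈-mono (x∧y≤y _ _) x∧y∈F)
               (λ (x∈F , y∈F) → ∧-∈ x∈F y∈F)

    ∨-comm-∈ : ∀ {x y} → x ∨ y ∈ F → y ∨ x ∈ F
    ∨-comm-∈ = ∈-resp-≈ (∨-comm _ _)

    ⋀∨-∈ : ∀ {k} (g : Fin (suc k) → Carrier) x → (∀ j → g j ∨ x ∈ F) → ⋀ L g ∨ x ∈ F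
    ⋀∨-∈ {zero}  g x g∨x∈F = g∨x∈F zero
    ⋀∨-∈ {suc k} g x g∨x∈F =
      ∈-resp-≈ (≈-sym (∨-distribʳ-∧ x _ _)) (∧-∈ (g∨x∈F zero) (⋀∨-∈ (g ∘ suc) x (g∨x∈F ∘ suc)))

  IsPrime : ∀ {q} → Pred Carrier q → Set (c ⊔ q)
  IsPrime Q = ∀ {x y} → x ∨ y ∈ Q → x ∈ Q ⊎ y ∈ Q

  record IsPrimeFilter {q} (Q : Pred Carrier q) : Set (c ⊔ ℓ ⊔ q) where
    field
      isFilter : IsFilter L Q
      isPrime  : IsPrime Q

    open FilterProperties isFilter public

    ∨-∈⇔ : ∀ {x y} → x ∨ y ∈ Q ⇔ (x ∈ Q ⊎ y ∈ Q)
    ∨-∈⇔ = mk⇔ isPrime [ ∈-mono (x≤x∨y _ _) , ∈-mono (y≤x∨y _ _) ]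

    ⊇complete⇒∈⊎~∈ : ∀ {p} {F : Pred Carrier p} → IsComplete L F → (∀ {x} → x ∈ F → x ∈ Q) →
                     ∀ x → x ∈ Q ⊎ ~ x ∈ Q
    ⊇complete⇒∈⊎~∈ ((x₀ , x₀∈F) , absorb) F⊆Q x = isPrime (∈-mono (x∧y≤y x₀ _) (F⊆Q (absorb x₀ x x₀∈F)))

    ⋁-∈ : ∀ {k} (g : Fin (suc k) → Carrier) → ⋁ L g ∈ Q → ∃ λ j → g j ∈ Q
    ⋁-∈ {zero}  g g₀∈Q = zero , g₀∈Q
    ⋁-∈ {suc k} g ⋁g∈Q with isPrime ⋁g∈Q
    ... | inj₁ g₀∈Q    = zero , g₀∈Q
    ... | inj₂ ⋁tail∈Q with ⋁-∈ (g ∘ suc) ⋁tail∈Q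
    ...   | j , gⱼ₊₁∈Q  = suc j , gⱼ₊₁∈Q

  ⋂-isNPrimeFilter : ∀ {m p q} {F : Pred Carrier p} (Q : Fin (suc m) → Pred Carrier q) →
                     (∀ i → IsPrimeFilter (Q i)) → (∀ x → x ∈ F ⇔ (∀ i → x ∈ Q i)) →
                     IsNPrimeFilter L (suc m) F
  ⋂-isNPrimeFilter {m} {F = F} Q Q-prime F≐⋂Q = (upward , meet) , (λ x≤y y∉F → y∉F ∘ upward x≤y) , ideal
    where
    module Qᵢ i = IsPrimeFilter (Q-prime i)
    to : ∀ {x} → x ∈ F → ∀ i → x ∈ Q i
    to = Equivalence.to (F≐⋂Q _)
    from : ∀ {x} → (∀ i → x ∈ Q i) → x ∈ F
    from = Equivalence.from (F≐⋂Q _)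

    upward : IsUpset L F
    upward x≤y x∈F = from λ i → proj₁ (Qᵢ.isFilter i) x≤y (to x∈F i)

    meet : ∀ {x y} → x ∈ F → y ∈ F → x ∧ y ∈ F
    meet x∈F y∈F = from λ i → Qᵢ.∧-∈ i (to x∈F i) (to y∈F i)

    ideal : ∀ k (Y : Fin (suc k) → Carrier) →
            (∀ m′ (X : Fin (suc m′) → Fin (suc k)) → suc m′ ≤ suc m → ⋁ L (Y ∘ X) ∉ F) →
            ⋁ L Y ∉ F
    ideal k Y small∉F ⋁Y∈F =
      small∉F m X ℕ-≤-refl (from λ i → Qᵢ.∈-mono i (⋁-upper (Y ∘ X) i) (proj₂ (picked i)))
      where
      picked : ∀ i → ∃ λ l → Y l ∈ Q i
      picked i = Qᵢ.⋁-∈ i Y (to ⋁Y∈F i)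
      X : Fin (suc m) → Fin (suc k)
      X = proj₁ ∘ picked

  module _ {n} {h : Carrier → Fin n → DM4} (h-hom : IsDMHom L n h) where
    open IsDMHom h-hom

    preimage-isPrimeFilter : ∀ {U D} → IsPrimeFilterWithin U D → (∀ x i → U (h x i)) →
                             ∀ i → IsPrimeFilter (λ x → D (h x i))
    preimage-isPrimeFilter {D = D} D-prime h∈U i = record
      { isFilter = (λ {x} {y} x∧y≈x → upward (≡.trans (≡.sym (hom-∧ x y i)) (cong x∧y≈x i)))
                 , (λ {x} {y} Dx Dy → ≡.subst D (≡.sym (hom-∧ x y i)) (meet Dx Dy))
      ; isPrime  = λ {x} {y} Dx∨y → prime (h∈U x i) (h∈U y i) (≡.subst D (hom-∨ x y i) Dx∨y)
      }
      where open IsPrimeFilterWithin D-prime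

    hom-∨~ : ∀ x i → h (x ∨ ~ x) i ≡ h x i ⊔₄ neg₄ (h x i)
    hom-∨~ x i = ≡.trans (hom-∨ x (~ x) i) (≡.cong (h x i ⊔₄_) (hom-~ x i))

    hom-∧~ : ∀ x i → h (x ∧ ~ x) i ≡ h x i ⊓ neg₄ (h x i)
    hom-∧~ x i = ≡.trans (hom-∧ x (~ x) i) (≡.cong (h x i ⊓_) (hom-~ x i))

  module _ {p} {U D : DM4 → Set} {F : Pred Carrier p} where

    homPreimage⇒nPrime : ∀ {m} → IsPrimeFilterWithin U D → IsHomPreimage L (suc m) U D F →
                         IsNPrimeFilter L (suc m) F
    homPreimage⇒nPrime D-prime (h , h-hom , h∈U , F≐) =
      ⋂-isNPrimeFilter _ (preimage-isPrimeFilter h-hom D-prime h∈U) F≐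

    homPreimage⇒complete : ∀ {n} → Carrier → IsPrimeFilterWithin U D →
                           (∀ v → U v → D (v ⊔₄ neg₄ v)) → IsHomPreimage L n U D F → IsComplete L F
    homPreimage⇒complete x₀ D-prime D-⊔neg (h , h-hom , h∈U , F≐) =
      (x₀ ∨ ~ x₀ , from (∨~-∈ x₀)) , λ x y x∈F → from λ i → Qᵢ.∧-∈ i (Equivalence.to (F≐ x) x∈F i) (∨~-∈ y i)
      where
      module Qᵢ i = IsPrimeFilter (preimage-isPrimeFilter h-hom D-prime h∈U i)
      from : ∀ {x} → (∀ i → D (h x i)) → x ∈ F
      from = Equivalence.from (F≐ _)
      ∨~-∈ : ∀ x i → D (h (x ∨ ~ x) i)
      ∨~-∈ x i = ≡.subst D (≡.sym (hom-∨~ h-hom x i)) (D-⊔neg _ (h∈U x i))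

    homPreimage⇒consistent : ∀ {m} → Carrier → (∀ v → ¬ D (v ⊓ neg₄ v)) →
                             (∀ {v w} → U v → U w → D ((v ⊓ neg₄ v) ⊔₄ w) → D w) →
                             IsHomPreimage L (suc m) U D F → IsConsistent L F
    homPreimage⇒consistent x₀ D-⊓neg D-absorb (h , h-hom , h∈U , F≐) =
      (λ F-full → D-⊓neg (h x₀ zero) (≡.subst D (hom-∧~ h-hom x₀ zero) (to (F-full (x₀ ∧ ~ x₀)) zero))) ,
      λ x y x∧~x∨y∈F → Equivalence.from (F≐ y) λ i →
        D-absorb (h∈U x i) (h∈U y i)
          (≡.subst D (≡.trans (hom-∨ (x ∧ ~ x) y i) (≡.cong (_⊔₄ h y i) (hom-∧~ h-hom x i)))
            (to x∧~x∨y∈F i))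
      where
      open IsDMHom h-hom using (hom-∨)
      to : ∀ {x} → x ∈ F → ∀ i → D (h x i)
      to = Equivalence.to (F≐ _)

  residual : ∀ {p} → Pred Carrier p → Carrier → Pred Carrier p
  residual F a x = x ∨ a ∈ F

  IsSpread : ∀ {p k} → Pred Carrier p → (Fin k → Carrier) → Set p
  IsSpread F a = (∀ i → a i ∉ F) × (∀ {i j} → i ≢ j → a i ∨ a j ∈ F)

  spread-∘ : ∀ {p k k′} {F : Pred Carrier p} {a : Fin k → Carrier} {σ : Fin k′ → Fin k} →
             Injective _≡_ _≡_ σ → IsSpread F a → IsSpread F (a ∘ σ)
  spread-∘ σ-injective (a∉F , a-pairwise) = a∉F ∘ _ , λ i≢j → a-pairwise (i≢j ∘ σ-injective)

  module _ {p} {F : Pred Carrier p} (F-filter : IsFilter L F) where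
    open FilterProperties F-filter

    residual-isFilter : ∀ a → IsFilter L (residual F a)
    residual-isFilter a =
      (λ x∧y≈x → ∈-mono (∨-monotonic (≈-sym x∧y≈x) ≼-refl)) ,
      (λ x∨a∈F y∨a∈F → ∈-resp-≈ (≈-sym (∨-distribʳ-∧ a _ _)) (∧-∈ x∨a∈F y∨a∈F))

    ⊆-residual : ∀ {x} a → x ∈ F → x ∈ residual F a
    ⊆-residual a = ∈-mono (x≤x∨y _ a)

    residual-consistent : IsConsistent L F → ∀ {a} → a ∉ F →
                          ∀ {x} → x ∈ residual F a → ~ x ∈ residual F a → ⊥
    residual-consistent (_ , absorb) a∉F x∨a∈F ~x∨a∈F =
      a∉F (absorb _ _ (∈-resp-≈ (≈-sym (∨-distribʳ-∧ _ _ _)) (∧-∈ x∨a∈F ~x∨a∈F)))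

    spread-∷ : ∀ {k} {a : Fin k → Carrier} {x} → IsSpread F a → x ∉ F → (∀ i → x ∨ a i ∈ F) →
               IsSpread F (x ∷ a)
    spread-∷ {a = a} {x} (a∉F , a-pairwise) x∉F x∨a∈F = (λ { zero → x∉F ; (suc i) → a∉F i }) , pairwise
      where
      pairwise : ∀ {i j} → i ≢ j → (x ∷ a) i ∨ (x ∷ a) j ∈ F
      pairwise {zero}  {zero}  0≢0 = ⊥-elim (0≢0 refl)
      pairwise {zero}  {suc j} _   = x∨a∈F j
      pairwise {suc i} {zero}  _   = ∨-comm-∈ (x∨a∈F i)
      pairwise {suc i} {suc j} i≢j = a-pairwise (i≢j ∘ ≡.cong suc)

    spread-split : ∀ {k} {a : Fin k → Carrier} → IsSpread F a → ∀ j {b c} → b ∉ F → c ∉ F →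
                   b ∨ c ∈ F → a j ≼ b → a j ≼ c → ∃ (IsSpread {k = suc k} F)
    spread-split {zero}  _ ()
    spread-split {suc k} {a} a-spread@(_ , a-pairwise) j {b} {c} b∉F c∉F b∨c∈F aⱼ≼b aⱼ≼c =
      b ∷ c ∷ a ∘ punchIn j ,
      spread-∷ (spread-∷ a∘punchIn-spread c∉F (above aⱼ≼c)) b∉F
               (λ { zero → b∨c∈F ; (suc i) → above aⱼ≼b i })
      where
      a∘punchIn-spread : IsSpread F (a ∘ punchIn j)
      a∘punchIn-spread = spread-∘ {F = F} (λ {i} {i′} → punchIn-injective j i i′) a-spread
      above : ∀ {d} → a j ≼ d → ∀ i → d ∨ a (punchIn j i) ∈ F
      above aⱼ≼d i = ∈-mono (∨-monotonic aⱼ≼d ≼-refl) (a-pairwise (punchInᵢ≢i j i ∘ ≡.sym))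

    -- By distributivity ⋁ᵢ ⋀_{j≠i} aⱼ = ⋀_{i≠j} (aᵢ ∨ aⱼ).
    ⋁⋀punchIn-∈ : ∀ {k} (a : Fin (suc (suc k)) → Carrier) → (∀ {i j} → i ≢ j → a i ∨ a j ∈ F) →
                  ⋁ L (λ i → ⋀ L (a ∘ punchIn i)) ∈ F
    ⋁⋀punchIn-∈ {zero}  a a-pairwise = a-pairwise {suc zero} {zero} λ ()
    ⋁⋀punchIn-∈ {suc k} a a-pairwise = ∈-resp-≈ distrib (∧-∈ W∨a₀∈F (∈-mono (y≤x∨y W Z) Z∈F))
      where
      a′ : Fin (suc (suc k)) → Carrier
      a′ = a ∘ suc
      W Z : Carrier
      W = ⋀ L a′
      Z = ⋁ L (λ i → ⋀ L (a′ ∘ punchIn i))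
      Z∈F : Z ∈ F
      Z∈F = ⋁⋀punchIn-∈ a′ (λ i≢j → a-pairwise (i≢j ∘ suc-injective))
      W∨a₀∈F : W ∨ a zero ∈ F
      W∨a₀∈F = ⋀∨-∈ a′ (a zero) (λ j → a-pairwise {suc j} {zero} λ ())
      distrib : (W ∨ a zero) ∧ (W ∨ Z) ≈ W ∨ ⋁ L (λ i → a zero ∧ ⋀ L (a′ ∘ punchIn i))
      distrib = ≈-trans (≈-sym (∨-distribˡ-∧ W (a zero) Z))
                        (∨-congˡ (∧-distribˡ-⋁ (a zero) (λ i → ⋀ L (a′ ∘ punchIn i))))

    nIdeal⇒¬IsSpread : ∀ {m} → IsNIdeal L (suc m) (∁ F) → (a : Fin (suc (suc m)) → Carrier) → ¬ IsSpread F a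
    nIdeal⇒¬IsSpread {m} (_ , ∁F-ideal) a (a∉F , a-pairwise) =
      ∁F-ideal (suc m) Y small∉F (⋁⋀punchIn-∈ a a-pairwise)
      where
      Y : Fin (suc (suc m)) → Carrier
      Y i = ⋀ L (a ∘ punchIn i)
      small∉F : ∀ m′ (X : Fin (suc m′) → Fin (suc (suc m))) → suc m′ ≤ suc m → ⋁ L (Y ∘ X) ∉ F
      small∉F m′ X size with ∃-∉-image (s≤s size) X
      ... | i₀ , X≢i₀ = a∉F i₀ ∘ ∈-mono (⋁-least (Y ∘ X) Y∘X≼aᵢ₀)
        where
        Y∘X≼aᵢ₀ : ∀ l → Y (X l) ≼ a i₀
        Y∘X≼aᵢ₀ l = ≡.subst (λ i → Y (X l) ≼ a i) (punchIn-punchOut (X≢i₀ l))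
                             (⋀-lower (a ∘ punchIn (X l)) (punchOut (X≢i₀ l)))

  module LargestSpread {p} {F : Pred Carrier p} (em : ExcludedMiddle p) (F-filter : IsFilter L F)
                       {k} {a : Fin k → Carrier} (a-spread : IsSpread F a)
                       (¬larger : ¬ ∃ (IsSpread {k = suc k} F)) where
    open FilterProperties F-filter

    ⋂residual⊆ : ∀ {x} → (∀ i → x ∈ residual F (a i)) → x ∈ F
    ⋂residual⊆ x∨a∈F = decidable-stable em λ x∉F → ¬larger (_ , spread-∷ F-filter a-spread x∉F x∨a∈F)

    residual-isPrime : ∀ j → IsPrime (residual F (a j))
    residual-isPrime j {x} {y} x∨y∨aⱼ∈F with em {x ∨ a j ∈ F} | em {y ∨ a j ∈ F}
    ... | yes x∨aⱼ∈F | _          = inj₁ x∨aⱼ∈F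
    ... | no _       | yes y∨aⱼ∈F = inj₂ y∨aⱼ∈F
    ... | no x∨aⱼ∉F  | no y∨aⱼ∉F  =
      ⊥-elim (¬larger (spread-split F-filter a-spread j x∨aⱼ∉F y∨aⱼ∉F joined (y≤x∨y x (a j)) (y≤x∨y y (a j))))
      where
      joined : (x ∨ a j) ∨ (y ∨ a j) ∈ F
      joined = ∈-mono (∨-least (∨-monotonic (x≤x∨y x (a j)) (x≤x∨y y (a j)))
                               (≼-trans (y≤x∨y x (a j)) (x≤x∨y _ _)))
                      x∨y∨aⱼ∈F

  record PrimeDecomposition {p} (n : ℕ) (F : Pred Carrier p) : Set (c ⊔ ℓ ⊔ Level.suc p) where
    field
      Q             : Fin n → Pred Carrier p
      isPrimeFilter : ∀ i → IsPrimeFilter (Q i)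
      F≐⋂Q          : ∀ x → x ∈ F ⇔ (∀ i → x ∈ Q i)
      Q-consistent  : IsConsistent L F → ∀ i {x} → x ∈ Q i → ~ x ∈ Q i → ⊥

  ∃-largestSpread : ∀ {p m} {F : Pred Carrier p} → ExcludedMiddle (c ⊔ p) → IsNPrimeFilter L (suc m) F →
                    ∃ λ k → k ≤ suc m × ∃ (IsSpread {k = k} F) × ¬ ∃ (IsSpread {k = suc k} F)
  ∃-largestSpread {m = m} {F} em (F-filter , ∁F-ideal) =
    threshold (λ _ → em) ((λ ()) , (λ ()) , λ { {()} }) (suc m)
              (λ (a , a-spread) → nIdeal⇒¬IsSpread F-filter ∁F-ideal a a-spread)

  -- If the largest spread family is empty, F = L; otherwise its k+1 ≤ n residuals
  -- are repeated along clamp to give exactly n of them.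
  decompose : ∀ {p m} {F : Pred Carrier p} → ExcludedMiddle (c ⊔ ℓ ⊔ p) →
              IsNPrimeFilter L (suc m) F → PrimeDecomposition (suc m) F
  decompose {F = F} em F-nprime@(F-filter , _) with ∃-largestSpread (lowerEM ℓ em) F-nprime
  ... | zero , _ , (a , a-spread) , ¬larger = record
    { Q             = λ _ → F
    ; isPrimeFilter = λ _ → record { isFilter = F-filter ; isPrime = λ _ → inj₁ (F-full _) }
    ; F≐⋂Q          = λ x → mk⇔ (λ x∈F _ → x∈F) (λ _ → F-full x)
    ; Q-consistent  = λ (F≢L , _) → ⊥-elim (F≢L F-full)
    }
    where
    open LargestSpread (lowerEM (c ⊔ ℓ) em) F-filter a-spread ¬larger
    F-full : ∀ x → x ∈ F
    F-full x = ⋂residual⊆ λ ()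
  ... | suc k , s≤s k≤m , (a , a-spread) , ¬larger = record
    { Q             = residual F ∘ a ∘ clamp k≤m
    ; isPrimeFilter = λ i → record { isFilter = residual-isFilter F-filter _
                                   ; isPrime  = residual-isPrime (clamp k≤m i) }
    ; F≐⋂Q          = λ x → mk⇔ (λ x∈F _ → ⊆-residual F-filter _ x∈F) ⋂Q⊆F
    ; Q-consistent  = λ F-consistent i →
                        residual-consistent F-filter F-consistent (proj₁ a-spread (clamp k≤m i))
    }
    where
    open LargestSpread (lowerEM (c ⊔ ℓ) em) F-filter a-spread ¬larger
    ⋂Q⊆F : ∀ {x} → (∀ i → x ∈ residual F (a (clamp k≤m i))) → x ∈ F
    ⋂Q⊆F {x} x∈Q = ⋂residual⊆ λ j →
      ≡.subst (λ j′ → x ∈ residual F (a j′)) (clamp-inject≤ k≤m j) (x∈Q (inject≤ j (s≤s k≤m)))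

  module Twist {q} (em : ExcludedMiddle q) {Q : Pred Carrier q} (Q-prime : IsPrimeFilter Q) where
    open IsPrimeFilter Q-prime
    open ≡.≡-Reasoning

    χ : Carrier → Bool
    χ x = does (em {x ∈ Q})

    χ-cong : ∀ {x y} → x ≈ y → χ x ≡ χ y
    χ-cong x≈y = does-⇔ (mk⇔ (∈-resp-≈ x≈y) (∈-resp-≈ (≈-sym x≈y))) em em

    χ-∧ : ∀ x y → χ (x ∧ y) ≡ χ x ∧ᵇ χ y
    χ-∧ x y = does-⇔ ∧-∈⇔ em (em ×-dec em)

    χ-∨ : ∀ x y → χ (x ∨ y) ≡ χ x ∨ᵇ χ y
    χ-∨ x y = does-⇔ ∨-∈⇔ em (em ⊎-dec em)

    twist : Carrier → DM4
    twist x = code (χ x) (χ (~ x))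

    twist-cong : ∀ {x y} → x ≈ y → twist x ≡ twist y
    twist-cong x≈y = ≡.cong₂ code (χ-cong x≈y) (χ-cong (~-cong x≈y))

    twist-∧ : ∀ x y → twist (x ∧ y) ≡ twist x ⊓ twist y
    twist-∧ x y = begin
      code (χ (x ∧ y)) (χ (~ (x ∧ y)))        ≡⟨ ≡.cong (code _) (χ-cong (deMorgan-∧ x y)) ⟩
      code (χ (x ∧ y)) (χ (~ x ∨ ~ y))        ≡⟨ ≡.cong₂ code (χ-∧ x y) (χ-∨ (~ x) (~ y)) ⟩
      code (χ x ∧ᵇ χ y) (χ (~ x) ∨ᵇ χ (~ y))  ≡⟨ code-⊓ (χ x) (χ (~ x)) (χ y) (χ (~ y)) ⟨
      twist x ⊓ twist y                        ∎

    twist-∨ : ∀ x y → twist (x ∨ y) ≡ twist x ⊔₄ twist y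
    twist-∨ x y = begin
      code (χ (x ∨ y)) (χ (~ (x ∨ y)))        ≡⟨ ≡.cong (code _) (χ-cong (deMorgan-∨ x y)) ⟩
      code (χ (x ∨ y)) (χ (~ x ∧ ~ y))        ≡⟨ ≡.cong₂ code (χ-∨ x y) (χ-∧ (~ x) (~ y)) ⟩
      code (χ x ∨ᵇ χ y) (χ (~ x) ∧ᵇ χ (~ y))  ≡⟨ code-⊔ (χ x) (χ (~ x)) (χ y) (χ (~ y)) ⟨
      twist x ⊔₄ twist y                       ∎

    twist-~ : ∀ x → twist (~ x) ≡ neg₄ (twist x)
    twist-~ x = begin
      code (χ (~ x)) (χ (~ (~ x)))  ≡⟨ ≡.cong (code _) (χ-cong (~-involutive x)) ⟩
      code (χ (~ x)) (χ x)          ≡⟨ code-neg (χ x) (χ (~ x)) ⟨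
      neg₄ (twist x)                ∎

    Des-tb-twist : ∀ x → Des-tb (twist x) ⇔ x ∈ Q
    Des-tb-twist x = ⇔-trans (Des-tb-code _ _) (does≡true⇔ em)

    twist≢𝗇 : ∀ {x} → x ∈ Q ⊎ ~ x ∈ Q → twist x ≢ 𝗇
    twist≢𝗇 = code≢𝗇 ∘ Sum.map (dec-true em) (dec-true em)

    module _ {x} (¬both : ¬ (x ∈ Q × ~ x ∈ Q)) where

      twist≢𝖻 : twist x ≢ 𝖻
      twist≢𝖻 = code≢𝖻 λ (χx , χ~x) →
        ¬both (Equivalence.to (does≡true⇔ em) χx , Equivalence.to (does≡true⇔ em) χ~x)

      twist≡𝗍⇔ : twist x ≡ 𝗍 ⇔ x ∈ Q
      twist≡𝗍⇔ = ⇔-trans (code≡𝗍 _ _)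
        (mk⇔ (Equivalence.to (does≡true⇔ em) ∘ proj₁)
             (λ x∈Q → dec-true em x∈Q , dec-false em (λ ~x∈Q → ¬both (x∈Q , ~x∈Q))))

  module _ {p n} {F : Pred Carrier p} (em : ExcludedMiddle (c ⊔ ℓ ⊔ p)) (D : PrimeDecomposition n F) where
    open PrimeDecomposition D
    module Twistᵢ i = Twist (lowerEM (c ⊔ ℓ) em) (isPrimeFilter i)

    twistⁿ : Carrier → Fin n → DM4
    twistⁿ x i = Twistᵢ.twist i x

    twistⁿ-isDMHom : IsDMHom L n twistⁿ
    twistⁿ-isDMHom = record
      { cong  = λ x≈y i → Twistᵢ.twist-cong i x≈y
      ; hom-∧ = λ x y i → Twistᵢ.twist-∧ i x y
      ; hom-∨ = λ x y i → Twistᵢ.twist-∨ i x y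
      ; hom-~ = λ x i → Twistᵢ.twist-~ i x
      }

    F≐⋂ : ∀ {P : Carrier → Fin n → Set} → (∀ x i → P x i ⇔ x ∈ Q i) → ∀ x → x ∈ F ⇔ (∀ i → P x i)
    F≐⋂ P⇔Q x = mk⇔ (λ x∈F i → from (P⇔Q x i) (to (F≐⋂Q x) x∈F i))
                     (λ Px → from (F≐⋂Q x) λ i → to (P⇔Q x i) (Px i))
      where open Equivalence

    ∈Q⊎~∈Q : IsComplete L F → ∀ x i → x ∈ Q i ⊎ ~ x ∈ Q i
    ∈Q⊎~∈Q F-complete x i =
      IsPrimeFilter.⊇complete⇒∈⊎~∈ (isPrimeFilter i) F-complete (λ x∈F → Equivalence.to (F≐⋂Q _) x∈F i) x

    ¬∈Q×~∈Q : IsConsistent L F → ∀ i {x} → ¬ (x ∈ Q i × ~ x ∈ Q i)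
    ¬∈Q×~∈Q F-consistent i (x∈Q , ~x∈Q) = Q-consistent F-consistent i x∈Q ~x∈Q

    decomposition⇒DM₁ : IsHomPreimage L n UnivDM₁ DesDM₁ F
    decomposition⇒DM₁ = twistⁿ , twistⁿ-isDMHom , (λ _ _ → tt) , F≐⋂ (λ x i → Twistᵢ.Des-tb-twist i x)

    decomposition⇒P₁ : IsComplete L F → IsHomPreimage L n UnivP₁ DesP₁ F
    decomposition⇒P₁ F-complete =
      twistⁿ , twistⁿ-isDMHom , (λ x i → Twistᵢ.twist≢𝗇 i (∈Q⊎~∈Q F-complete x i)) ,
      F≐⋂ (λ x i → Twistᵢ.Des-tb-twist i x)

    decomposition⇒K₁ : IsConsistent L F → IsHomPreimage L n UnivK₁ DesK₁ F
    decomposition⇒K₁ F-consistent =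
      twistⁿ , twistⁿ-isDMHom , (λ x i → Twistᵢ.twist≢𝖻 i (¬∈Q×~∈Q F-consistent i)) ,
      F≐⋂ (λ x i → Twistᵢ.twist≡𝗍⇔ i (¬∈Q×~∈Q F-consistent i))

    decomposition⇒B₁ : IsClassical L F → IsHomPreimage L n UnivB₁ DesB₁ F
    decomposition⇒B₁ (F-complete , F-consistent) =
      twistⁿ , twistⁿ-isDMHom ,
      (λ x i → Twistᵢ.twist≢𝗇 i (∈Q⊎~∈Q F-complete x i) , Twistᵢ.twist≢𝖻 i (¬∈Q×~∈Q F-consistent i)) ,
      F≐⋂ (λ x i → Twistᵢ.twist≡𝗍⇔ i (¬∈Q×~∈Q F-consistent i))

mainTheorem4 : ∀ {c ℓ p} → ExcludedMiddle (c ⊔ ℓ ⊔ p) →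
    (L : DeMorganLattice c ℓ) → DeMorganLattice.Carrier L →
    (n : ℕ) → 1 ≤ n → (F : Pred (DeMorganLattice.Carrier L) p) →
    (IsNPrimeFilter L n F ⇔ IsHomPreimage L n UnivDM₁ DesDM₁ F) ×
    ((IsNPrimeFilter L n F × IsComplete L F) ⇔ IsHomPreimage L n UnivP₁ DesP₁ F) ×
    ((IsNPrimeFilter L n F × IsConsistent L F) ⇔ IsHomPreimage L n UnivK₁ DesK₁ F) ×
    ((IsNPrimeFilter L n F × IsClassical L F) ⇔ IsHomPreimage L n UnivB₁ DesB₁ F)
mainTheorem4 em L x₀ (suc m) (s≤s z≤n) F =
  mk⇔ (decomposition⇒DM₁ L em ∘ decompose L em)
      (homPreimage⇒nPrime L DesDM₁-isPrimeFilterWithin) ,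
  mk⇔ (λ (F-nprime , F-complete) → decomposition⇒P₁ L em (decompose L em F-nprime) F-complete)
      (λ F≐h⁻¹ → homPreimage⇒nPrime L DesP₁-isPrimeFilterWithin F≐h⁻¹ ,
                 homPreimage⇒complete L x₀ DesP₁-isPrimeFilterWithin Des-tb-⊔neg F≐h⁻¹) ,
  mk⇔ (λ (F-nprime , F-consistent) → decomposition⇒K₁ L em (decompose L em F-nprime) F-consistent)
      (λ F≐h⁻¹ → homPreimage⇒nPrime L DesK₁-isPrimeFilterWithin F≐h⁻¹ ,
                 homPreimage⇒consistent L {U = UnivK₁} {D = DesK₁} x₀ ⊓neg≢𝗍 ⊓neg-⊔-≡𝗍 F≐h⁻¹) ,
  mk⇔ (λ (F-nprime , F-classical) → decomposition⇒B₁ L em (decompose L em F-nprime) F-classical)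
      (λ F≐h⁻¹ → homPreimage⇒nPrime L DesB₁-isPrimeFilterWithin F≐h⁻¹ ,
                 homPreimage⇒complete L x₀ DesB₁-isPrimeFilterWithin ⊔neg≡𝗍 F≐h⁻¹ ,
                 homPreimage⇒consistent L {U = UnivB₁} {D = DesB₁} x₀ ⊓neg≢𝗍
                   (λ Uv Uw → ⊓neg-⊔-≡𝗍 (proj₂ Uv) (proj₂ Uw)) F≐h⁻¹)
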